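{- Let $n\ge2$, let $E=(S_1,\dots,S_T)$ be a sequence of non-empty hyperedges $S_t\subseteq[n]$, and run the algorithm RAND described in the context on $E$. Fix a step $t\in\{1,\dots,T\}$ and fix any outcome of RAND's random choices in steps $1,\dots,t-1$. Let $S=S_t$, and let $p_S=\min_{j\in S}p^{t-1}(j)$. Fix a node $i\in S$ and let $p=p^{t-1}(i)$. If $p\le p_S+h-1$, then, with probability taken only over RAND's random choices in step $t$, the event $c^t_{i,p}=c^{t-1}_{i,p}+1$ occurs with probability exactly $(2^p-c^{t-1}_{i,p})/(h\cdot 2^p)$.
   Context: Nodes are $[n]$, and $h=\lceil\log_2 n\rceil$. For integers $k\ge0$, let $R_k=\{2^k,\dots,2^{k+1}-1\}$ (so $|R_k|=2^k$) and $q_k=\lceil(1-\tfrac{1}{2n})2^k\rceil$. Algorithm RAND. For each node $i$ it maintains a phase $p(i)$, initially $0$, and for each $k\ge0$ a set $C_{i,k}$, initially empty. When hyperedge $S$ arrives, RAND does the following. - Let $p_S=\min_{i\in S}p(i)$, using the current phases. - Sample $k^*$ uniformly from $\{p_S,\dots,p_S+h-1\}$. - Sample a color $r$ uniformly from $R_{k^*}$, and color $S$ with $r$. - For each $i\in S$: set $C_{i,k^*}\leftarrow C_{i,k^*}\cup\{r\}$; then, if $|C_{i,p(i)}|\ge q_{p(i)}$, set $p(i)\leftarrow p(i)+1$. Notation: $c_{i,k}=|C_{i,k}|$. The superscript $t$ denotes the value of a variable at the end of step $t$, and superscript $t-1$ the value at the end of step $t-1$ (before step $t$). In particular, $p^{t-1}(i)$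 is the phase of node $i$ before step $t$. -}

module Defs where

open import Data.Nat using (ℕ; zero; suc; _+_; _*_; _∸_; _^_; _≤_; _<_; _≤?_; _⊓_)
open import Data.Nat.Properties using (_≟_)
import Data.Nat.DivMod as ND
open import Data.Nat.Logarithm using (⌈log₂_⌉)
open import Data.Bool using (Bool; true; false; if_then_else_)
open import Data.Fin using (Fin; zero; suc)
open import Data.Fin.Subset using (Subset)
open import Data.Vec using (Vec; []; _∷_; lookup)
open import Data.List using (List; []; _∷_; length; foldr)
open import Data.List.Membership.DecPropositional _≟_ using (_∈?_)
open import Data.Product using (_×_)
open import Data.Integer using (+_)
open import Data.Rational using (ℚ; 0ℚ) renaming (_+_ to _+ℚ_; _/_ to _/ℚ_)
open import Relation.Nullary.Decidable using (does)
open import Function using (_∘_)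

hOf : ℕ → ℕ
hOf n = ⌈log₂ n ⌉

-- ceiling division ⌈x / d⌉ (d = 0 gives 0; never used with d = 0)
ceilDiv : ℕ → ℕ → ℕ
ceilDiv x zero = zero
ceilDiv x (suc d) = (x + d) ND./ suc d

-- q_k = ⌈(1 - 1/(2n)) 2^k⌉ = ⌈(2n - 1) 2^k / (2n)⌉
qOf : ℕ → ℕ → ℕ
qOf n k = ceilDiv ((2 * n ∸ 1) * 2 ^ k) (2 * n)

-- the rational a / b  (b = 0 gives 0; never used with b = 0)
_÷ℕ_ : ℕ → ℕ → ℚ
a ÷ℕ zero = 0ℚ
a ÷ℕ suc b = (+ a) /ℚ suc b

Σℚ<_ : ℕ → (ℕ → ℚ) → ℚ
Σℚ< zero = λ f → 0ℚ
Σℚ< suc m = λ f → (Σℚ< m) f +ℚ f m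

-- Finite sets of colours as duplicate-free lists; |C| = length C

insert : ℕ → List ℕ → List ℕ
insert r C = if does (r ∈? C) then C else r ∷ C

-- State of RAND on nodes Fin n (node i ∈ [n] is Fin index i-1)

record State (n : ℕ) : Set where
  field
    phase : Fin n → ℕ
    col   : Fin n → ℕ → List ℕ

open State public

initState : (n : ℕ) → State n
initState n = record { phase = λ _ → 0 ; col = λ _ _ → [] }

cnt : {n : ℕ} → State n → Fin n → ℕ → ℕ
cnt st i k = length (col st i k)

phasesIn : {n : ℕ} → Subset n → (Fin n → ℕ) → List ℕ
phasesIn [] f = []
phasesIn (true ∷ S) f = f zero ∷ phasesIn S (f ∘ suc)
phasesIn (false ∷ S) f = phasesIn S (f ∘ suc)

minL : List ℕ → ℕ
minL [] = 0
minL (x ∷ xs) = foldr _⊓_ x xs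

pS : {n : ℕ} → State n → Subset n → ℕ
pS st S = minL (phasesIn S (phase st))

-- One step of RAND on hyperedge S, with the random choices encoded as
--   k* = p_S + j   (j ∈ {0,…,h-1})   and   r = 2^{k*} + o   (o ∈ {0,…,2^{k*}-1}).
step : {n : ℕ} → State n → Subset n → ℕ → ℕ → State n
step {n} st S j o = record { phase = newPhase ; col = newCol }
  where
    k* : ℕ
    k* = pS st S + j
    r : ℕ
    r = 2 ^ k* + o
    newCol : Fin n → ℕ → List ℕ
    newCol i k = if lookup S i
                   then (if does (k ≟ k*) then insert r (col st i k) else col st i k)
                   else col st i k
    newPhase : Fin n → ℕ
    newPhase i = if lookup S i
                   then (if does (qOf n (phase st i) ≤? length (newCol i (phase st i)))
                           then suc (phase st i) else phase st i)
                   else phase st i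

-- the choices (j , o) are admissible: k* uniform-range and r ∈ R_{k*}
ValidChoice : {n : ℕ} → State n → Subset n → ℕ → ℕ → Set
ValidChoice {n} st S j o = (j < hOf n) × (o < 2 ^ (pS st S + j))

data Reach {n : ℕ} : State n → List (Subset n) → State n → Set where
  reach-[] : {s : State n} → Reach s [] s
  reach-∷  : {s s' : State n} {S : Subset n} {Es : List (Subset n)} (j o : ℕ) →
             ValidChoice s S j o → Reach (step s S j o) Es s' → Reach s (S ∷ Es) s'

-- Probability, over the random choices of one step on S from state st,
-- that c_{i,k} increases by exactly one.
-- Outcome (j , o) has probability 1/h · 1/2^{p_S + j}.
probIncr : {n : ℕ} → State n → Subset n → Fin n → ℕ → ℚ
probIncr {n} st S i k =
  (Σℚ< hOf n) λ j → (Σℚ< (2 ^ (pS st S + j))) λ o →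
    if does (cnt (step st S j o) i k ≟ suc (cnt st i k))
      then 1 ÷ℕ (hOf n * 2 ^ (pS st S + j))
      else 0ℚ

{-# OPTIONS --safe #-}
-- Let k* = p_S + j be the level chosen by RAND.  The count c_{i,p} can only
-- change if k* = p, i.e. for the single value j = p - p_S, which lies in the
-- sampled range exactly when p ≤ p_S + h - 1.  For that j, c_{i,p} grows by
-- one iff the colour r, uniform in R_p, is not yet in C_{i,p}.  Since C_{i,p}
-- is always a duplicate-free subset of R_p, this happens for 2^p - c_{i,p} of
-- the 2^p equally likely colours, each of probability 1/(h 2^p).
module Submission where

open import Defs
open import Data.Nat using (ℕ; _≤_; _+_; _∸_; _*_; _^_)
open import Data.Fin using (Fin; toℕ)
open import Data.Fin.Subset using (Subset; Nonempty; _∈_)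
open import Data.List using (List; length; take; lookup)
open import Data.List.Relation.Unary.All using (All)
open import Relation.Binary.PropositionalEquality using (_≡_)

open import Data.Nat using (zero; suc; _<_; _⊓_; z<s)
open import Data.Nat.Properties
open import Data.Nat.Logarithm using (⌈log₂⌉-mono-≤)
open import Data.Bool using (Bool; true; false; if_then_else_; not; _∧_; _∨_)
open import Data.Vec using (_∷_) renaming (lookup to lookupᵥ)
import Data.Vec as Vec
open import Data.Vec.Properties using ([]=⇒lookup)
open import Data.Fin using (suc)
open import Data.List using ([]; _∷_)
open import Data.List.Properties using (foldr-preservesᵒ)
open import Data.List.Relation.Unary.All using ([]; _∷_)
open import Data.List.Relation.Unary.All.Properties.Core using (All¬⇒¬Any; ¬Any⇒All¬)
open import Data.List.Relation.Unary.Any using (Any; here; there)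
import Data.List.Relation.Unary.Any as Any
open import Data.List.Relation.Unary.AllPairs using ([]; _∷_)
open import Data.List.Relation.Unary.Unique.Propositional using (Unique)
open import Data.List.Membership.DecPropositional _≟_ using (_∈?_)
import Data.List.Membership.Propositional as List
open import Data.Product using (_×_; _,_; proj₁; proj₂)
open import Data.Sum using (_⊎_; [_,_]; inj₁; inj₂)
open import Function using (_∘_)
open import Relation.Nullary using (Dec; yes; no; does; contradiction)
open import Relation.Nullary.Decidable using (dec-true; dec-false)
open import Relation.Binary.PropositionalEquality
  using (_≢_; refl; sym; trans; cong; cong₂; subst; module ≡-Reasoning)
open import Data.Integer as ℤ using (+_)
import Data.Integer.Properties as ℤ
open import Data.Integer.Solver using (module +-*-Solver)
open import Data.Rational using (ℚ; 0ℚ; toℚᵘ) renaming (_+_ to _+ℚ_)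
import Data.Rational.Properties as ℚ
open import Data.Rational.Unnormalised using (mkℚᵘ; *≡*) renaming (_+_ to _+ᵘ_; _≃_ to _≃ᵘ_)
import Data.Rational.Unnormalised.Properties as ℚᵘ

0÷ℕ : ∀ d → 0 ÷ℕ d ≡ 0ℚ
0÷ℕ zero    = refl
0÷ℕ (suc d) = ℚ.0/n≡0 (suc d)

mkℚᵘ-+-numerator-1 : ∀ a d → mkℚᵘ (+ a) d +ᵘ mkℚᵘ (+ 1) d ≃ᵘ mkℚᵘ (+ suc a) d
mkℚᵘ-+-numerator-1 a d = *≡* (trans
  (solve 2 (λ A D → (A :* D :+ con (+ 1) :* D) :* D := (con (+ 1) :+ A) :* (D :* D)) refl (+ a) (+ suc d))
  (cong (+ suc a ℤ.*_) (sym (ℤ.pos-* (suc d) (suc d)))))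
  where open +-*-Solver

÷ℕ-+-1÷ℕ : ∀ a d → a ÷ℕ d +ℚ 1 ÷ℕ d ≡ suc a ÷ℕ d
÷ℕ-+-1÷ℕ a zero    = refl
÷ℕ-+-1÷ℕ a (suc d) = ℚ.toℚᵘ-injective (begin
  toℚᵘ (a ÷ℕ suc d +ℚ 1 ÷ℕ suc d)           ≈⟨ ℚ.toℚᵘ-homo-+ (a ÷ℕ suc d) (1 ÷ℕ suc d) ⟩
  toℚᵘ (a ÷ℕ suc d) +ᵘ toℚᵘ (1 ÷ℕ suc d)    ≈⟨ ℚᵘ.+-cong (ℚ.toℚᵘ-fromℚᵘ (mkℚᵘ (+ a) d)) (ℚ.toℚᵘ-fromℚᵘ (mkℚᵘ (+ 1) d)) ⟩
  mkℚᵘ (+ a) d +ᵘ mkℚᵘ (+ 1) d              ≈⟨ mkℚᵘ-+-numerator-1 a d ⟩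
  mkℚᵘ (+ suc a) d                          ≈⟨ ℚ.toℚᵘ-fromℚᵘ (mkℚᵘ (+ suc a) d) ⟨
  toℚᵘ (suc a ÷ℕ suc d)                     ∎)
  where open ℚᵘ.≃-Reasoning

Σℚ<-cong : ∀ m {f g : ℕ → ℚ} → (∀ x → x < m → f x ≡ g x) → (Σℚ< m) f ≡ (Σℚ< m) g
Σℚ<-cong zero    f≗g = refl
Σℚ<-cong (suc m) f≗g = cong₂ _+ℚ_ (Σℚ<-cong m (λ x x<m → f≗g x (m<n⇒m<1+n x<m))) (f≗g m ≤-refl)

Σℚ<-zero : ∀ m {f : ℕ → ℚ} → (∀ x → x < m → f x ≡ 0ℚ) → (Σℚ< m) f ≡ 0ℚ
Σℚ<-zero zero    f≗0 = refl
Σℚ<-zero (suc m) f≗0 = cong₂ _+ℚ_ (Σℚ<-zero m (λ x x<m → f≗0 x (m<n⇒m<1+n x<m))) (f≗0 m ≤-refl)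

Σℚ<-single : ∀ m {f : ℕ → ℚ} {d} → d < m → (∀ x → x < m → x ≢ d → f x ≡ 0ℚ) → (Σℚ< m) f ≡ f d
Σℚ<-single (suc m) {f} {d} d<1+m f≗0 with d ≟ m
... | yes refl = begin
  (Σℚ< m) f +ℚ f d  ≡⟨ cong (_+ℚ f d) (Σℚ<-zero m (λ x x<m → f≗0 x (m<n⇒m<1+n x<m) (<⇒≢ x<m))) ⟩
  0ℚ +ℚ f d         ≡⟨ ℚ.+-identityˡ (f d) ⟩
  f d               ∎
  where open ≡-Reasoning
... | no d≢m = begin
  (Σℚ< m) f +ℚ f m  ≡⟨ cong₂ _+ℚ_ (Σℚ<-single m d<m (λ x x<m → f≗0 x (m<n⇒m<1+n x<m))) (f≗0 m ≤-refl (d≢m ∘ sym)) ⟩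
  f d +ℚ 0ℚ         ≡⟨ ℚ.+-identityʳ (f d) ⟩
  f d               ∎
  where
    open ≡-Reasoning
    d<m : d < m
    d<m = ≤∧≢⇒< (≤-pred d<1+m) d≢m

count< : ℕ → (ℕ → Bool) → ℕ
count< zero    b = 0
count< (suc m) b = if b m then suc (count< m b) else count< m b

Σℚ<-indicator : ∀ m (b : ℕ → Bool) d →
                (Σℚ< m) (λ x → if b x then 1 ÷ℕ d else 0ℚ) ≡ count< m b ÷ℕ d
Σℚ<-indicator zero    b d = sym (0÷ℕ d)
Σℚ<-indicator (suc m) b d with b m
... | true  = trans (cong (_+ℚ 1 ÷ℕ d) (Σℚ<-indicator m b d)) (÷ℕ-+-1÷ℕ (count< m b) d)
... | false = trans (ℚ.+-identityʳ _) (Σℚ<-indicator m b d)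

count<-suc-true : ∀ m {b : ℕ → Bool} → b m ≡ true → count< (suc m) b ≡ suc (count< m b)
count<-suc-true m {b} bm≡true = cong (λ bm → if bm then suc (count< m b) else count< m b) bm≡true

count<-suc-false : ∀ m {b : ℕ → Bool} → b m ≡ false → count< (suc m) b ≡ count< m b
count<-suc-false m {b} bm≡false = cong (λ bm → if bm then suc (count< m b) else count< m b) bm≡false

count<-zero : ∀ m {b : ℕ → Bool} → (∀ x → x < m → b x ≡ false) → count< m b ≡ 0
count<-zero zero    b≗false = refl
count<-zero (suc m) b≗false =
  trans (count<-suc-false m (b≗false m ≤-refl)) (count<-zero m (λ x x<m → b≗false x (m<n⇒m<1+n x<m)))

count<-not : ∀ m (b : ℕ → Bool) → count< m (not ∘ b) + count< m b ≡ m
count<-not zero    b = refl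
count<-not (suc m) b with b m
... | true  = trans (+-suc _ _) (cong suc (count<-not m b))
... | false = cong suc (count<-not m b)

count<-∨ : ∀ m (b c : ℕ → Bool) → (∀ x → b x ∧ c x ≡ false) →
           count< m (λ x → b x ∨ c x) ≡ count< m b + count< m c
count<-∨ zero    b c disjoint = refl
count<-∨ (suc m) b c disjoint with b m | c m | disjoint m | count<-∨ m b c disjoint
... | true  | true  | () | _
... | true  | false | _  | ih = cong suc ih
... | false | true  | _  | ih = trans (cong suc ih) (sym (+-suc _ _))
... | false | false | _  | ih = ih

count<-hit : ∀ m {a x} → a ≤ x → x < a + m → count< m (λ y → does (a + y ≟ x)) ≡ 1
count<-hit zero    {a} {x} a≤x x<a+0 = contradiction (subst (x <_) (+-identityʳ a) x<a+0) (≤⇒≯ a≤x)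
count<-hit (suc m) {a} {x} a≤x x<a+1+m with a + m ≟ x
... | yes refl = trans (count<-suc-true m (dec-true (a + m ≟ a + m) refl))
  (cong suc (count<-zero m (λ y y<m → dec-false (a + y ≟ a + m) (<⇒≢ (+-monoʳ-< a y<m)))))
... | no a+m≢x = trans (count<-suc-false m (dec-false (a + m ≟ x) a+m≢x))
  (count<-hit m a≤x (≤∧≢⇒< (≤-pred (subst (x <_) (+-suc a m) x<a+1+m)) (a+m≢x ∘ sym)))

InRange : ℕ → ℕ → ℕ → Set
InRange a m x = a ≤ x × x < a + m

count<-∈ : ∀ m a (C : List ℕ) → Unique C → All (InRange a m) C →
           count< m (λ y → does (a + y ∈? C)) ≡ length C
count<-∈ m a []      _                _                          = count<-zero m (λ _ _ → refl)
count<-∈ m a (x ∷ C) (x∉C ∷ unique) ((a≤x , x<a+m) ∷ inRange) = begin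
  count< m (λ y → does (a + y ∈? (x ∷ C)))                                 ≡⟨ count<-∨ m _ _ disjoint ⟩
  count< m (λ y → does (a + y ≟ x)) + count< m (λ y → does (a + y ∈? C))  ≡⟨ cong₂ _+_ (count<-hit m a≤x x<a+m) (count<-∈ m a C unique inRange) ⟩
  suc (length C)                                                           ∎
  where
    open ≡-Reasoning
    disjoint : ∀ y → does (a + y ≟ x) ∧ does (a + y ∈? C) ≡ false
    disjoint y with a + y ≟ x
    ... | no a+y≢x = cong (_∧ does (a + y ∈? C)) (dec-false (a + y ≟ x) a+y≢x)
    ... | yes refl = trans (cong (_∧ does (a + y ∈? C)) (dec-true (a + y ≟ a + y) refl))
                           (dec-false (a + y ∈? C) (All¬⇒¬Any x∉C))

count<-∉ : ∀ m a (C : List ℕ) → Unique C → All (InRange a m) C →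
           count< m (λ y → not (does (a + y ∈? C))) ≡ m ∸ length C
count<-∉ m a C unique inRange = begin
  count< m (not ∘ ∈C)                           ≡⟨ m+n∸n≡m _ (length C) ⟨
  count< m (not ∘ ∈C) + length C ∸ length C     ≡⟨ cong (λ k → count< m (not ∘ ∈C) + k ∸ length C) (count<-∈ m a C unique inRange) ⟨
  count< m (not ∘ ∈C) + count< m ∈C ∸ length C  ≡⟨ cong (_∸ length C) (count<-not m ∈C) ⟩
  m ∸ length C                                  ∎
  where
    open ≡-Reasoning
    ∈C : ℕ → Bool
    ∈C y = does (a + y ∈? C)

-- The invariant of RAND that makes c_{i,k} the number of colours of R_k already in C_{i,k}.
ColourSet : ℕ → List ℕ → Set
ColourSet k C = Unique C × All (InRange (2 ^ k) (2 ^ k)) C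

WellFormed : ∀ {n} → State n → Set
WellFormed {n} st = ∀ (i : Fin n) k → ColourSet k (col st i k)

insert-ColourSet : ∀ k {r C} → InRange (2 ^ k) (2 ^ k) r → ColourSet k C → ColourSet k (insert r C)
insert-ColourSet k {r} {C} r∈R (unique , inRange) with r ∈? C
... | yes _   = unique , inRange
... | no  r∉C = ¬Any⇒All¬ C r∉C ∷ unique , r∈R ∷ inRange

length-insert≟suc : ∀ r C → does (length (insert r C) ≟ suc (length C)) ≡ not (does (r ∈? C))
length-insert≟suc r C with r ∈? C
... | yes _ = dec-false (length C ≟ suc (length C)) (<⇒≢ (n<1+n _))
... | no  _ = dec-true (suc (length C) ≟ suc (length C)) refl

col-step-≢ : ∀ {n} (st : State n) S j o i {k} → k ≢ pS st S + j → col (step st S j o) i k ≡ col st i k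
col-step-≢ st S j o i {k} k≢k* with lookupᵥ S i
... | false = refl
... | true  = cong (if_then insert (2 ^ k* + o) (col st i k) else col st i k) (dec-false (k ≟ k*) k≢k*)
  where
    k* : ℕ
    k* = pS st S + j

col-step-∈ : ∀ {n} (st : State n) S j o i → lookupᵥ S i ≡ true →
             col (step st S j o) i (pS st S + j) ≡ insert (2 ^ (pS st S + j) + o) (col st i (pS st S + j))
col-step-∈ st S j o i i∈S rewrite i∈S =
  cong (if_then insert (2 ^ k* + o) (col st i k*) else col st i k*) (dec-true (k* ≟ k*) refl)
  where
    k* : ℕ
    k* = pS st S + j

step-WellFormed : ∀ {n} (st : State n) S j o → ValidChoice st S j o → WellFormed st → WellFormed (step st S j o)
step-WellFormed st S j o (_ , o<2^k*) wf i k with lookupᵥ S i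
... | false = wf i k
... | true  = level-updated (k ≟ pS st S + j)
  where
    level-updated : (k≟k* : Dec (k ≡ pS st S + j)) →
                    ColourSet k (if does k≟k* then insert (2 ^ (pS st S + j) + o) (col st i k) else col st i k)
    level-updated (yes refl) = insert-ColourSet k (m≤m+n _ o , +-monoʳ-< _ o<2^k*) (wf i k)
    level-updated (no _)     = wf i k

Reach-WellFormed : ∀ {n} {s s' : State n} {Es} → Reach s Es s' → WellFormed s → WellFormed s'
Reach-WellFormed reach-[]                      wf = wf
Reach-WellFormed (reach-∷ {s} {S = S} j o v r) wf = Reach-WellFormed r (step-WellFormed s S j o v wf)

phasesIn-∈ : ∀ {n} {S : Subset n} {i} (f : Fin n → ℕ) → i ∈ S → f i List.∈ phasesIn S f
phasesIn-∈ {S = true  ∷ _} f Vec.here        = here refl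
phasesIn-∈ {S = true  ∷ _} f (Vec.there i∈S) = there (phasesIn-∈ (f ∘ suc) i∈S)
phasesIn-∈ {S = false ∷ _} f (Vec.there i∈S) = phasesIn-∈ (f ∘ suc) i∈S

minL-≤ : ∀ {xs y} → y List.∈ xs → minL xs ≤ y
minL-≤ {x ∷ xs} {y} y∈x∷xs = foldr-preservesᵒ ⊓-≤ x xs (from y∈x∷xs)
  where
    ⊓-≤ : ∀ a b → a ≤ y ⊎ b ≤ y → a ⊓ b ≤ y
    ⊓-≤ a b = [ m≤n⇒m⊓o≤n b , m≤n⇒o⊓m≤n a ]
    from : y List.∈ x ∷ xs → x ≤ y ⊎ Any (_≤ y) xs
    from (here y≡x)   = inj₁ (≤-reflexive (sym y≡x))
    from (there y∈xs) = inj₂ (Any.map (≤-reflexive ∘ sym) y∈xs)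

pS-≤-phase : ∀ {n} (st : State n) {S i} → i ∈ S → pS st S ≤ phase st i
pS-≤-phase st i∈S = minL-≤ (phasesIn-∈ (phase st) i∈S)

probIncr-sampled-level : ∀ {n} (st : State n) S i j → WellFormed st → i ∈ S → j < hOf n →
                         let k = pS st S + j in
                         probIncr st S i k ≡ (2 ^ k ∸ cnt st i k) ÷ℕ (hOf n * 2 ^ k)
probIncr-sampled-level {n} st S i j wf i∈S j<h = begin
  probIncr st S i k
    ≡⟨ Σℚ<-single (hOf n) j<h other-levels-vanish ⟩
  (Σℚ< (2 ^ k)) (λ o → if does (cnt (step st S j o) i k ≟ suc c) then 1 ÷ℕ d else 0ℚ)
    ≡⟨ Σℚ<-cong (2 ^ k) (λ o _ → cong (if_then 1 ÷ℕ d else 0ℚ) (grows⇔fresh o)) ⟩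
  (Σℚ< (2 ^ k)) (λ o → if not (does (2 ^ k + o ∈? C)) then 1 ÷ℕ d else 0ℚ)
    ≡⟨ Σℚ<-indicator (2 ^ k) (λ o → not (does (2 ^ k + o ∈? C))) d ⟩
  count< (2 ^ k) (λ o → not (does (2 ^ k + o ∈? C))) ÷ℕ d
    ≡⟨ cong (_÷ℕ d) (count<-∉ (2 ^ k) (2 ^ k) C unique inRange) ⟩
  (2 ^ k ∸ c) ÷ℕ d
    ∎
  where
    open ≡-Reasoning
    k : ℕ
    k = pS st S + j
    C : List ℕ
    C = col st i k
    c : ℕ
    c = length C
    d : ℕ
    d = hOf n * 2 ^ k
    unique : Unique C
    unique = proj₁ (wf i k)
    inRange : All (InRange (2 ^ k) (2 ^ k)) C
    inRange = proj₂ (wf i k)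

    grows⇔fresh : ∀ o → does (cnt (step st S j o) i k ≟ suc c) ≡ not (does (2 ^ k + o ∈? C))
    grows⇔fresh o = trans (cong (λ D → does (length D ≟ suc c)) (col-step-∈ st S j o i ([]=⇒lookup i∈S)))
                          (length-insert≟suc (2 ^ k + o) C)

    other-levels-vanish : ∀ j′ → j′ < hOf n → j′ ≢ j →
      (Σℚ< (2 ^ (pS st S + j′))) (λ o →
        if does (cnt (step st S j′ o) i k ≟ suc c) then 1 ÷ℕ (hOf n * 2 ^ (pS st S + j′)) else 0ℚ) ≡ 0ℚ
    other-levels-vanish j′ _ j′≢j =
      Σℚ<-zero (2 ^ (pS st S + j′)) (λ o _ → cong (if_then 1 ÷ℕ (hOf n * 2 ^ (pS st S + j′)) else 0ℚ) (unchanged o))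
      where
        unchanged : ∀ o → does (cnt (step st S j′ o) i k ≟ suc c) ≡ false
        unchanged o = trans (cong (λ D → does (length D ≟ suc c)) (col-step-≢ st S j′ o i (j′≢j ∘ sym ∘ +-cancelˡ-≡ _ _ _)))
                            (dec-false (c ≟ suc c) (<⇒≢ (n<1+n c)))

lemma11 : (n : ℕ) → 2 ≤ n → (E : List (Subset n)) → All Nonempty E →
          (t : Fin (length E)) → (st : State n) →
          Reach (initState n) (take (toℕ t) E) st →
          (i : Fin n) → i ∈ lookup E t →
          phase st i ≤ pS st (lookup E t) + hOf n ∸ 1 →
          probIncr st (lookup E t) i (phase st i)
            ≡ (2 ^ phase st i ∸ cnt st i (phase st i)) ÷ℕ (hOf n * 2 ^ phase st i)
lemma11 n 2≤n E _ t st run i i∈S p≤pS+h∸1 =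
  subst (λ k → probIncr st S i k ≡ (2 ^ k ∸ cnt st i k) ÷ℕ (hOf n * 2 ^ k))
        (m+[n∸m]≡n (pS-≤-phase st i∈S))
        (probIncr-sampled-level st S i (phase st i ∸ pS st S) wf i∈S offset<h)
  where
    S : Subset n
    S = lookup E t
    wf : WellFormed st
    wf = Reach-WellFormed run (λ _ _ → [] , [])
    1≤h : 1 ≤ hOf n
    1≤h = ⌈log₂⌉-mono-≤ 2≤n
    offset<h : phase st i ∸ pS st S < hOf n
    offset<h = ≤-<-trans (m≤n+o⇒m∸n≤o (phase st i) (pS st S) p≤pS+[h∸1]) (∸-monoʳ-< z<s 1≤h)
      where
        p≤pS+[h∸1] : phase st i ≤ pS st S + (hOf n ∸ 1)
        p≤pS+[h∸1] = ≤-trans p≤pS+h∸1 (≤-reflexive (+-∸-assoc (pS st S) 1≤h))
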